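{- For every even integer $\ell \geq 4$ with $\ell \not\equiv 0 \pmod 6$, the cartesian product $C_3 \,\square\, C_\ell$ (of order $3\ell$) is a nut graph.
   Context: $C_m$ is the cycle on $m$ vertices. The cartesian product $G \,\square\, H$ has vertex set $V(G)\times V(H)$, with $(u,v)$ adjacent to $(u',v')$ iff ($uu' \in E(G)$ and $v=v'$) or ($u=u'$ and $vv'\in E(H)$). A nut graph is a simple connected graph whose adjacency matrix has one-dimensional kernel spanned by a vector with no zero entry. -}

module Defs where

open import Data.Nat using (ℕ; zero; suc; _+_; _*_; _≡ᵇ_)
open import Data.Nat.DivMod using (_%_)
open import Data.Fin using (Fin; zero; suc; toℕ; remQuot)
open import Data.Bool using (Bool; true; false; _∨_; _∧_; T)
open import Data.Product using (Σ; _×_; _,_; proj₁; proj₂; ∃)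
open import Data.Rational using (ℚ; 0ℚ; 1ℚ) renaming (_+_ to _+ℚ_; _*_ to _*ℚ_)
open import Relation.Binary.PropositionalEquality using (_≡_)
open import Relation.Nullary using (¬_)
open import Relation.Binary.Construct.Closure.ReflexiveTransitive using (Star)

-- A (loopless, undirected) graph on the vertex set Fin n is given by a
-- Boolean adjacency function; simplicity (symmetry, no loops) is imposed
-- as part of the nut-graph predicate below.
AdjFn : ℕ → Set
AdjFn n = Fin n → Fin n → Bool

cycle : (m : ℕ) → AdjFn m
cycle zero ()
cycle (suc k) i j =
  (((toℕ i + 1) % suc k) ≡ᵇ toℕ j) ∨ (((toℕ j + 1) % suc k) ≡ᵇ toℕ i)

_□_ : ∀ {a b} → AdjFn a → AdjFn b → AdjFn (a * b)
_□_ {a} {b} G H x y with remQuot b x | remQuot b y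
... | (u , v) | (u' , v') =
  (G u u' ∧ (toℕ v ≡ᵇ toℕ v')) ∨ ((toℕ u ≡ᵇ toℕ u') ∧ H v v')

∑ : (n : ℕ) → (Fin n → ℚ) → ℚ
∑ zero f = 0ℚ
∑ (suc n) f = f zero +ℚ ∑ n (λ i → f (suc i))

adjMatrix : ∀ {n} → AdjFn n → Fin n → Fin n → ℚ
adjMatrix G i j with G i j
... | true = 1ℚ
... | false = 0ℚ

InKernel : ∀ {n} → AdjFn n → (Fin n → ℚ) → Set
InKernel {n} G x = ∀ i → ∑ n (λ j → adjMatrix G i j *ℚ x j) ≡ 0ℚ

IsSimple : ∀ {n} → AdjFn n → Set
IsSimple G = (∀ i j → G i j ≡ G j i) × (∀ i → G i i ≡ false)

IsConnected : ∀ {n} → AdjFn n → Set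
IsConnected G = ∀ i j → Star (λ u v → T (G u v)) i j

IsNutGraph : ∀ {n} → AdjFn n → Set
IsNutGraph {n} G =
  IsSimple G × IsConnected G ×
  Σ (Fin n → ℚ) λ x →
    InKernel G x × (∀ i → ¬ (x i ≡ 0ℚ)) ×
    (∀ y → InKernel G y → ∃ λ (c : ℚ) → ∀ i → y i ≡ c *ℚ x i)

{-# OPTIONS --safe #-}
-- The adjacency operator of C₃ □ Cₗ sends y to the sum of its four neighbouring
-- values, so y is in its kernel iff y(u±1, v) + y(u, v±1) = 0 at every vertex.
-- The alternating vector (u, v) ↦ (-1)^v satisfies this once ℓ is even.
-- Conversely, subtracting the equations at two adjacent rows shows that the
-- difference of two rows obeys D(n+2) = D(n+1) − D(n); such a sequence has
-- period 6 and antiperiod 3, so as it also has period ℓ ≡ 2, 4 (mod 6) it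
-- vanishes. All three rows thus agree with one sequence f satisfying
-- f(n+2) + 2f(n+1) + f(n) = 0, i.e. (-1)^n f(n) is an arithmetic progression;
-- being periodic it is constant, so y is a multiple of the alternating vector.
module Submission where

open import Defs
open import Data.Nat using (ℕ; zero; suc; _+_; _*_; _≡ᵇ_; _≤_; _<_; s≤s; NonZero)
open import Data.Nat.DivMod
  using (_%_; _/_; m%n<n; m<n⇒m%n≡m; %-congˡ; [m+n]%n≡m%n; %-distribˡ-+; m%n%n≡m%n; m≡m%n+[m/n]*n;
         n%n≡0; m∣n⇒o%n%m≡o%m)
open import Data.Nat.Divisibility using (divides)
import Data.Nat.Properties as ℕ
open import Data.Fin using (Fin; zero; suc; toℕ; fromℕ; fromℕ<; inject₁; combine; remQuot; _↑ˡ_; _↑ʳ_)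
import Data.Fin.Properties as Fin
open import Data.Bool using (Bool; true; false; _∧_; _∨_; T)
import Data.Bool.Properties as Bool
open import Data.Product using (_×_; _,_; proj₁; proj₂)
open import Data.Sum using (_⊎_; inj₁; inj₂)
open import Data.Empty using (⊥; ⊥-elim)
open import Data.Integer using (+_)
open import Data.Rational using (ℚ; 0ℚ; 1ℚ; -_)
  renaming (_+_ to _+ℚ_; _*_ to _*ℚ_; _-_ to _-ℚ_; _/_ to _/ℚ_; _<_ to _<ℚ_)
import Data.Rational.Properties as ℚ
open import Algebra.Properties.Group ℚ.+-0-group using (⁻¹-involutive; x∙y⁻¹≈ε⇒x≈y)
open import Function using (_∘_; Equivalence)
open import Level using (0ℓ)
open import Relation.Binary.Construct.Closure.ReflexiveTransitive using (Star; ε; _◅_; _◅◅_; gmap; reverse)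
open import Relation.Binary.Definitions using (tri<; tri≈; tri>)
open import Relation.Binary.PropositionalEquality
open import Relation.Nullary using (¬_)
open import Relation.Nullary.Decidable using (dec⇒maybe)
open import Tactic.RingSolver using (solve-∀)
import Tactic.RingSolver.Core.AlmostCommutativeRing as ACR

open ≡-Reasoning

ℚ-ring : ACR.AlmostCommutativeRing 0ℓ 0ℓ
ℚ-ring = ACR.fromCommutativeRing ℚ.+-*-commutativeRing (λ x → dec⇒maybe (0ℚ ℚ.≟ x))

x+x+x≡0⇒x≡0 : ∀ {x} → x +ℚ (x +ℚ x) ≡ 0ℚ → x ≡ 0ℚ
x+x+x≡0⇒x≡0 {x} 3x≡0 = begin
  x                                  ≡⟨ thirds x ⟩
  (+ 1 /ℚ 3) *ℚ (x +ℚ (x +ℚ x))      ≡⟨ cong ((+ 1 /ℚ 3) *ℚ_) 3x≡0 ⟩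
  (+ 1 /ℚ 3) *ℚ 0ℚ                   ≡⟨ ℚ.*-zeroʳ (+ 1 /ℚ 3) ⟩
  0ℚ                                 ∎
  where
  thirds : ∀ x → x ≡ (+ 1 /ℚ 3) *ℚ (x +ℚ (x +ℚ x))
  thirds = solve-∀ ℚ-ring

T-extensional : ∀ {b c} → (T b → T c) → (T c → T b) → b ≡ c
T-extensional {false} {false} _ _ = refl
T-extensional {false} {true}  _ g = ⊥-elim (g _)
T-extensional {true}  {false} f _ = ⊥-elim (f _)
T-extensional {true}  {true}  _ _ = refl

∑-cong : ∀ n {f g : Fin n → ℚ} → (∀ i → f i ≡ g i) → ∑ n f ≡ ∑ n g
∑-cong zero    f≗g = refl
∑-cong (suc n) f≗g = cong₂ _+ℚ_ (f≗g zero) (∑-cong n (f≗g ∘ suc))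

∑-distrib-+ : ∀ n (f g : Fin n → ℚ) → ∑ n (λ i → f i +ℚ g i) ≡ ∑ n f +ℚ ∑ n g
∑-distrib-+ zero    f g = refl
∑-distrib-+ (suc n) f g =
  trans (cong (f zero +ℚ g zero +ℚ_) (∑-distrib-+ n (f ∘ suc) (g ∘ suc)))
        (interchange (f zero) (g zero) (∑ n (f ∘ suc)) (∑ n (g ∘ suc)))
  where
  interchange : ∀ a b c d → (a +ℚ b) +ℚ (c +ℚ d) ≡ (a +ℚ c) +ℚ (b +ℚ d)
  interchange = solve-∀ ℚ-ring

*-distribˡ-∑ : ∀ n c (f : Fin n → ℚ) → ∑ n (λ i → c *ℚ f i) ≡ c *ℚ ∑ n f
*-distribˡ-∑ zero    c f = sym (ℚ.*-zeroʳ c)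
*-distribˡ-∑ (suc n) c f =
  trans (cong (c *ℚ f zero +ℚ_) (*-distribˡ-∑ n c (f ∘ suc))) (sym (ℚ.*-distribˡ-+ c _ _))

∑-++ : ∀ m n (f : Fin (m + n) → ℚ) → ∑ (m + n) f ≡ ∑ m (λ i → f (i ↑ˡ n)) +ℚ ∑ n (λ j → f (m ↑ʳ j))
∑-++ zero    n f = sym (ℚ.+-identityˡ _)
∑-++ (suc m) n f = trans (cong (f zero +ℚ_) (∑-++ m n (f ∘ suc)))
  (sym (ℚ.+-assoc (f zero) (∑ m (λ i → f (suc (i ↑ˡ n)))) (∑ n (λ j → f (suc (m ↑ʳ j))))))

∑-combine : ∀ a b (f : Fin (a * b) → ℚ) → ∑ (a * b) f ≡ ∑ a (λ u → ∑ b (λ v → f (combine u v)))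
∑-combine zero    b f = refl
∑-combine (suc a) b f =
  trans (∑-++ b (a * b) f) (cong (∑ b (λ v → f (v ↑ˡ a * b)) +ℚ_) (∑-combine a b (λ i → f (b ↑ʳ i))))

indicator : Bool → ℚ
indicator true  = 1ℚ
indicator false = 0ℚ

indicator-∧ : ∀ b c → indicator (b ∧ c) ≡ indicator b *ℚ indicator c
indicator-∧ true  c = sym (ℚ.*-identityˡ (indicator c))
indicator-∧ false c = sym (ℚ.*-zeroˡ (indicator c))

indicator-∨ : ∀ b c → (T b → T c → ⊥) → indicator (b ∨ c) ≡ indicator b +ℚ indicator c
indicator-∨ true  true  disjoint = ⊥-elim (disjoint _ _)
indicator-∨ true  false _        = refl
indicator-∨ false c     _        = sym (ℚ.+-identityˡ _)

adjMatrix≡indicator : ∀ {n} (G : AdjFn n) i j → adjMatrix G i j ≡ indicator (G i j)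
adjMatrix≡indicator G i j with G i j
... | true  = refl
... | false = refl

_·_ : ∀ {n} → AdjFn n → (Fin n → ℚ) → Fin n → ℚ
_·_ {n} G x i = ∑ n (λ j → adjMatrix G i j *ℚ x j)

Path : ∀ {n} → AdjFn n → Fin n → Fin n → Set
Path G = Star (λ u v → T (G u v))

rooted⇒connected : ∀ {n} {G : AdjFn n} → (∀ i j → G i j ≡ G j i) →
  (r : Fin n) → (∀ i → Path G r i) → IsConnected G
rooted⇒connected G-sym r path i j = reverse (λ {u} {v} → subst T (G-sym u v)) (path i) ◅◅ path j

_==_ : ∀ {n} → Fin n → Fin n → Bool
a == b = toℕ a ≡ᵇ toℕ b

==⇒≡ : ∀ {n} {a b : Fin n} → T (a == b) → a ≡ b
==⇒≡ {a = a} {b} a==b = Fin.toℕ-injective (ℕ.≡ᵇ⇒≡ (toℕ a) (toℕ b) a==b)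

≡⇒== : ∀ {n} {a b : Fin n} → a ≡ b → T (a == b)
≡⇒== {a = a} refl = ℕ.≡⇒≡ᵇ (toℕ a) (toℕ a) refl

==-sym : ∀ {n} (a b : Fin n) → (a == b) ≡ (b == a)
==-sym a b = T-extensional (λ t → ≡⇒== (sym (==⇒≡ {a = a} {b} t)))
                            (λ t → ≡⇒== (sym (==⇒≡ {a = b} {a} t)))

δ : ∀ {n} → Fin n → Fin n → ℚ
δ a b = indicator (a == b)

∑-δ : ∀ n (a : Fin n) (z : Fin n → ℚ) → ∑ n (λ j → δ a j *ℚ z j) ≡ z a
∑-δ (suc n) zero z = begin
  1ℚ *ℚ z zero +ℚ ∑ n (λ j → 0ℚ *ℚ z (suc j))
    ≡⟨ cong₂ _+ℚ_ (ℚ.*-identityˡ (z zero)) (∑-cong n (ℚ.*-zeroˡ ∘ z ∘ suc)) ⟩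
  z zero +ℚ ∑ n (λ _ → 0ℚ)
    ≡⟨ cong (z zero +ℚ_) (∑-zero n) ⟩
  z zero +ℚ 0ℚ
    ≡⟨ ℚ.+-identityʳ _ ⟩
  z zero
    ∎
  where
  ∑-zero : ∀ n → ∑ n (λ _ → 0ℚ) ≡ 0ℚ
  ∑-zero zero    = refl
  ∑-zero (suc n) = trans (ℚ.+-identityˡ _) (∑-zero n)
∑-δ (suc n) (suc a) z = trans (cong₂ _+ℚ_ (ℚ.*-zeroˡ (z zero)) (∑-δ n a (z ∘ suc))) (ℚ.+-identityˡ _)

∀-combine : ∀ {a b} {P : Fin (a * b) → Set} → (∀ (u : Fin a) (v : Fin b) → P (combine u v)) → ∀ i → P i
∀-combine {a} {b} {P} P-combine i =
  subst P (Fin.combine-remQuot {a} b i) (P-combine (proj₁ (remQuot {a} b i)) (proj₂ (remQuot {a} b i)))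

□-combine : ∀ {a b} (G : AdjFn a) (H : AdjFn b) u v u' v' →
  (G □ H) (combine u v) (combine u' v') ≡ (G u u' ∧ (v == v')) ∨ ((u == u') ∧ H v v')
□-combine {a} {b} G H u v u' v' =
  trans (unfold (combine u v) (combine u' v')) (cong₂ edge (Fin.remQuot-combine u v) (Fin.remQuot-combine u' v'))
  where
  edge : Fin a × Fin b → Fin a × Fin b → Bool
  edge (u , v) (u' , v') = (G u u' ∧ (v == v')) ∨ ((u == u') ∧ H v v')
  unfold : ∀ x y → (G □ H) x y ≡ edge (remQuot b x) (remQuot b y)
  unfold x y with remQuot {a} b x | remQuot {a} b y
  ... | _ , _ | _ , _ = refl

□-simple : ∀ {a b} {G : AdjFn a} {H : AdjFn b} → IsSimple G → IsSimple H → IsSimple (G □ H)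
□-simple {G = G} {H} (G-sym , G-loopless) (H-sym , H-loopless) = □-sym , □-loopless
  where
  □-sym : ∀ i j → (G □ H) i j ≡ (G □ H) j i
  □-sym = ∀-combine {P = λ i → ∀ j → (G □ H) i j ≡ (G □ H) j i} λ u v →
          ∀-combine {P = λ j → (G □ H) (combine u v) j ≡ (G □ H) j (combine u v)} λ u' v' → begin
    (G □ H) (combine u v) (combine u' v')          ≡⟨ □-combine G H u v u' v' ⟩
    (G u u' ∧ (v == v')) ∨ ((u == u') ∧ H v v')    ≡⟨ cong₂ _∨_ (cong₂ _∧_ (G-sym u u') (==-sym v v'))
                                                              (cong₂ _∧_ (==-sym u u') (H-sym v v')) ⟩
    (G u' u ∧ (v' == v)) ∨ ((u' == u) ∧ H v' v)    ≡⟨ □-combine G H u' v' u v ⟨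
    (G □ H) (combine u' v') (combine u v)          ∎
  □-loopless : ∀ i → (G □ H) i i ≡ false
  □-loopless = ∀-combine {P = λ i → (G □ H) i i ≡ false} λ u v → begin
    (G □ H) (combine u v) (combine u v)            ≡⟨ □-combine G H u v u v ⟩
    (G u u ∧ (v == v)) ∨ ((u == u) ∧ H v v)        ≡⟨ cong₂ (λ g h → (g ∧ (v == v)) ∨ ((u == u) ∧ h))
                                                            (G-loopless u) (H-loopless v) ⟩
    (u == u) ∧ false                               ≡⟨ Bool.∧-zeroʳ (u == u) ⟩
    false                                          ∎

□-connected : ∀ {a b} {G : AdjFn a} {H : AdjFn b} → IsConnected G → IsConnected H → IsConnected (G □ H)
□-connected {G = G} {H} G-connected H-connected =
  ∀-combine {P = λ i → ∀ j → Path (G □ H) i j} λ u v →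
  ∀-combine {P = Path (G □ H) (combine u v)} λ u' v' →
    gmap (λ w → combine w v) (horizontal v) (G-connected u u') ◅◅
    gmap (combine u') (vertical u') (H-connected v v')
  where
  horizontal : ∀ v {w w'} → T (G w w') → T ((G □ H) (combine w v) (combine w' v))
  horizontal v {w} {w'} e = subst T (sym (□-combine G H w v w' v))
    (Equivalence.from Bool.T-∨ (inj₁ (Equivalence.from Bool.T-∧ (e , ≡⇒== {a = v} refl))))
  vertical : ∀ u {w w'} → T (H w w') → T ((G □ H) (combine u w) (combine u w'))
  vertical u {w} {w'} e = subst T (sym (□-combine G H u w u w'))
    (Equivalence.from Bool.T-∨ (inj₂ (Equivalence.from Bool.T-∧ (≡⇒== {a = u} refl , e))))

adjMatrix-□ : ∀ {a b} {G : AdjFn a} (H : AdjFn b) → (∀ u → G u u ≡ false) → ∀ u v u' v' →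
  adjMatrix (G □ H) (combine u v) (combine u' v') ≡
  adjMatrix G u u' *ℚ δ v v' +ℚ δ u u' *ℚ adjMatrix H v v'
adjMatrix-□ {G = G} H G-loopless u v u' v' = begin
  adjMatrix (G □ H) (combine u v) (combine u' v')
    ≡⟨ adjMatrix≡indicator (G □ H) _ _ ⟩
  indicator ((G □ H) (combine u v) (combine u' v'))
    ≡⟨ cong indicator (□-combine G H u v u' v') ⟩
  indicator ((G u u' ∧ (v == v')) ∨ ((u == u') ∧ H v v'))
    ≡⟨ indicator-∨ _ _ disjoint ⟩
  indicator (G u u' ∧ (v == v')) +ℚ indicator ((u == u') ∧ H v v')
    ≡⟨ cong₂ _+ℚ_ (indicator-∧ (G u u') (v == v')) (indicator-∧ (u == u') (H v v')) ⟩
  indicator (G u u') *ℚ δ v v' +ℚ δ u u' *ℚ indicator (H v v')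
    ≡⟨ cong₂ (λ g h → g *ℚ δ v v' +ℚ δ u u' *ℚ h)
             (adjMatrix≡indicator G u u') (adjMatrix≡indicator H v v') ⟨
  adjMatrix G u u' *ℚ δ v v' +ℚ δ u u' *ℚ adjMatrix H v v'
    ∎
  where
  disjoint : T (G u u' ∧ (v == v')) → T ((u == u') ∧ H v v') → ⊥
  disjoint g h = subst T (trans (cong (G u) (sym u≡u')) (G-loopless u)) (proj₁ (Equivalence.to Bool.T-∧ g))
    where
    u≡u' : u ≡ u'
    u≡u' = ==⇒≡ (proj₁ (Equivalence.to Bool.T-∧ h))

□-· : ∀ {a b} {G : AdjFn a} (H : AdjFn b) → (∀ u → G u u ≡ false) → ∀ y u v →
  ((G □ H) · y) (combine u v) ≡ (G · (λ u' → y (combine u' v))) u +ℚ (H · (λ v' → y (combine u v'))) v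
□-· {a} {b} {G} H G-loopless y u v = begin
  ((G □ H) · y) (combine u v)
    ≡⟨ ∑-combine a b _ ⟩
  ∑ a (λ u' → ∑ b (λ v' → adjMatrix (G □ H) (combine u v) (combine u' v') *ℚ y′ u' v'))
    ≡⟨ ∑-cong a (λ u' → ∑-cong b (entry u')) ⟩
  ∑ a (λ u' → ∑ b (λ v' → g u' *ℚ (δ v v' *ℚ y′ u' v') +ℚ δ u u' *ℚ (h v' *ℚ y′ u' v')))
    ≡⟨ ∑-cong a inner ⟩
  ∑ a (λ u' → g u' *ℚ ∑ b (λ v' → δ v v' *ℚ y′ u' v') +ℚ δ u u' *ℚ ∑ b (λ v' → h v' *ℚ y′ u' v'))
    ≡⟨ ∑-distrib-+ a (λ u' → g u' *ℚ ∑ b (λ v' → δ v v' *ℚ y′ u' v'))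
                     (λ u' → δ u u' *ℚ ∑ b (λ v' → h v' *ℚ y′ u' v')) ⟩
  ∑ a (λ u' → g u' *ℚ ∑ b (λ v' → δ v v' *ℚ y′ u' v')) +ℚ ∑ a (λ u' → δ u u' *ℚ ∑ b (λ v' → h v' *ℚ y′ u' v'))
    ≡⟨ cong₂ _+ℚ_ (∑-cong a (λ u' → cong (g u' *ℚ_) (∑-δ b v (y′ u'))))
                  (∑-δ a u (λ u' → ∑ b (λ v' → h v' *ℚ y′ u' v'))) ⟩
  ∑ a (λ u' → g u' *ℚ y′ u' v) +ℚ ∑ b (λ v' → h v' *ℚ y′ u v')
    ∎
  where
  g : Fin a → ℚ
  g = adjMatrix G u
  h : Fin b → ℚ
  h = adjMatrix H v
  y′ : Fin a → Fin b → ℚ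
  y′ u' v' = y (combine u' v')
  distribute : ∀ p d e q z → (p *ℚ d +ℚ e *ℚ q) *ℚ z ≡ p *ℚ (d *ℚ z) +ℚ e *ℚ (q *ℚ z)
  distribute = solve-∀ ℚ-ring
  entry : ∀ u' v' → adjMatrix (G □ H) (combine u v) (combine u' v') *ℚ y′ u' v'
                    ≡ g u' *ℚ (δ v v' *ℚ y′ u' v') +ℚ δ u u' *ℚ (h v' *ℚ y′ u' v')
  entry u' v' = trans (cong (_*ℚ y′ u' v') (adjMatrix-□ {G = G} H G-loopless u v u' v'))
                      (distribute (g u') (δ v v') (δ u u') (h v') (y′ u' v'))
  inner : ∀ u' → ∑ b (λ v' → g u' *ℚ (δ v v' *ℚ y′ u' v') +ℚ δ u u' *ℚ (h v' *ℚ y′ u' v'))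
                 ≡ g u' *ℚ ∑ b (λ v' → δ v v' *ℚ y′ u' v') +ℚ δ u u' *ℚ ∑ b (λ v' → h v' *ℚ y′ u' v')
  inner u' = trans (∑-distrib-+ b (λ v' → g u' *ℚ (δ v v' *ℚ y′ u' v')) (λ v' → δ u u' *ℚ (h v' *ℚ y′ u' v')))
                   (cong₂ _+ℚ_ (*-distribˡ-∑ b (g u') (λ v' → δ v v' *ℚ y′ u' v'))
                               (*-distribˡ-∑ b (δ u u') (λ v' → h v' *ℚ y′ u' v')))

next : ∀ {k} → Fin (suc k) → Fin (suc k)
next {k} v = fromℕ< (m%n<n (toℕ v + 1) (suc k))

prev : ∀ {k} → Fin (suc k) → Fin (suc k)
prev {k} zero    = fromℕ k
prev     (suc w) = inject₁ w

toℕ-next : ∀ {k} (v : Fin (suc k)) → toℕ (next v) ≡ (toℕ v + 1) % suc k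
toℕ-next v = Fin.toℕ-fromℕ< _

next-prev : ∀ {k} (v : Fin (suc k)) → next (prev v) ≡ v
next-prev {k} zero = Fin.toℕ-injective (begin
  toℕ (next (fromℕ k))            ≡⟨ toℕ-next (fromℕ k) ⟩
  (toℕ (fromℕ k) + 1) % suc k     ≡⟨ %-congˡ (trans (cong (_+ 1) (Fin.toℕ-fromℕ k)) (ℕ.+-comm k 1)) ⟩
  suc k % suc k                   ≡⟨ n%n≡0 (suc k) ⟩
  0                               ∎)
next-prev {k} (suc w) = Fin.toℕ-injective (begin
  toℕ (next (inject₁ w))          ≡⟨ toℕ-next (inject₁ w) ⟩
  (toℕ (inject₁ w) + 1) % suc k   ≡⟨ %-congˡ (trans (cong (_+ 1) (Fin.toℕ-inject₁ w)) (ℕ.+-comm (toℕ w) 1)) ⟩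
  suc (toℕ w) % suc k             ≡⟨ m<n⇒m%n≡m (s≤s (Fin.toℕ<n w)) ⟩
  suc (toℕ w)                     ∎)

prev-next : ∀ {k} (v : Fin (suc k)) → prev (next v) ≡ v
prev-next {k} v with ℕ.m≤n⇒m<n∨m≡n (Fin.toℕ≤pred[n] v)
... | inj₁ v<k = Fin.toℕ-injective (prev-of-suc (next v)
      (trans (toℕ-next v) (trans (%-congˡ (ℕ.+-comm (toℕ v) 1)) (m<n⇒m%n≡m (s≤s v<k)))))
  where
  prev-of-suc : ∀ (b : Fin (suc k)) {m} → toℕ b ≡ suc m → toℕ (prev b) ≡ m
  prev-of-suc (suc w) eq = trans (Fin.toℕ-inject₁ w) (ℕ.suc-injective eq)
... | inj₂ v≡k = begin
  prev (next v)  ≡⟨ cong prev (Fin.toℕ-injective {j = zero} next-v≡0) ⟩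
  fromℕ k        ≡⟨ Fin.toℕ-injective (trans (Fin.toℕ-fromℕ k) (sym v≡k)) ⟩
  v              ∎
  where
  next-v≡0 : toℕ (next v) ≡ 0
  next-v≡0 = trans (toℕ-next v) (trans (%-congˡ (trans (cong (_+ 1) v≡k) (ℕ.+-comm k 1))) (n%n≡0 (suc k)))

prev≢id : ∀ {k} (v : Fin (2 + k)) → prev v ≢ v
prev≢id zero    ()
prev≢id (suc w) prev≡ = ℕ.m≢1+n+m (toℕ w) {0} (trans (sym (Fin.toℕ-inject₁ w)) (cong toℕ prev≡))

prev²≢id : ∀ {k} (v : Fin (3 + k)) → prev (prev v) ≢ v
prev²≢id zero             ()
prev²≢id (suc zero)       ()
prev²≢id (suc (suc w))    prev²≡ = ℕ.m≢1+n+m (toℕ w) {1}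
  (trans (sym (trans (Fin.toℕ-inject₁ (inject₁ w)) (Fin.toℕ-inject₁ w))) (cong toℕ prev²≡))

next≢id : ∀ {k} (v : Fin (2 + k)) → next v ≢ v
next≢id v next≡ = prev≢id v (trans (cong prev (sym next≡)) (prev-next v))

next≢prev : ∀ {k} (v : Fin (3 + k)) → next v ≢ prev v
next≢prev v next≡prev = prev²≢id v (trans (cong prev (sym next≡prev)) (prev-next v))

cycle-next : ∀ {k} (v w : Fin (suc k)) → cycle (suc k) v w ≡ (next v == w) ∨ (next w == v)
cycle-next v w = sym (cong₂ (λ m n → (m ≡ᵇ toℕ w) ∨ (n ≡ᵇ toℕ v)) (toℕ-next v) (toℕ-next w))

cycle-sym : ∀ {k} (v w : Fin (suc k)) → cycle (suc k) v w ≡ cycle (suc k) w v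
cycle-sym {k} v w = Bool.∨-comm (((toℕ v + 1) % suc k) ≡ᵇ toℕ w) (((toℕ w + 1) % suc k) ≡ᵇ toℕ v)

cycle-simple : ∀ {k} → IsSimple (cycle (2 + k))
cycle-simple = cycle-sym , λ v → trans (cycle-next v v) (cong (λ b → b ∨ b) (next==v≡false v))
  where
  next==v≡false : ∀ {k} (v : Fin (2 + k)) → (next v == v) ≡ false
  next==v≡false v = T-extensional (next≢id v ∘ ==⇒≡) (λ ())

walk : ∀ {k} → ℕ → Fin (suc k)
walk zero    = zero
walk (suc n) = next (walk n)

toℕ-walk : ∀ {k} n → toℕ (walk {k} n) ≡ n % suc k
toℕ-walk         zero    = refl
toℕ-walk {k = k} (suc n) = begin
  toℕ (next (walk n))               ≡⟨ toℕ-next (walk n) ⟩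
  (toℕ (walk n) + 1) % suc k        ≡⟨ cong (λ m → (m + 1) % suc k) (toℕ-walk n) ⟩
  (n % suc k + 1) % suc k           ≡⟨ %-distribˡ-+ (n % suc k) 1 (suc k) ⟩
  (n % suc k % suc k + 1 % suc k) % suc k  ≡⟨ cong (λ m → (m + 1 % suc k) % suc k) (m%n%n≡m%n n (suc k)) ⟩
  (n % suc k + 1 % suc k) % suc k   ≡⟨ %-distribˡ-+ n 1 (suc k) ⟨
  (n + 1) % suc k                   ≡⟨ %-congˡ (ℕ.+-comm n 1) ⟩
  suc n % suc k                     ∎

walk-toℕ : ∀ {k} (v : Fin (suc k)) → walk (toℕ v) ≡ v
walk-toℕ v = Fin.toℕ-injective (trans (toℕ-walk (toℕ v)) (m<n⇒m%n≡m (Fin.toℕ<n v)))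

cycle-connected : ∀ {k} → IsConnected (cycle (suc k))
cycle-connected {k} = rooted⇒connected cycle-sym zero
  (λ v → subst (Path (cycle (suc k)) zero) (walk-toℕ v) (path (toℕ v)))
  where
  next-adjacent : ∀ v → T (cycle (suc k) v (next v))
  next-adjacent v = subst T (sym (cycle-next v (next v))) (Equivalence.from Bool.T-∨ (inj₁ (≡⇒== {a = next v} refl)))
  path : ∀ n → Path (cycle (suc k)) zero (walk n)
  path zero    = ε
  path (suc n) = path n ◅◅ (next-adjacent (walk n) ◅ ε)

adjMatrix-cycle : ∀ {k} (v w : Fin (3 + k)) → adjMatrix (cycle (3 + k)) v w ≡ δ (next v) w +ℚ δ (prev v) w
adjMatrix-cycle v w = begin
  adjMatrix (cycle _) v w
    ≡⟨ adjMatrix≡indicator (cycle _) v w ⟩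
  indicator (cycle _ v w)
    ≡⟨ cong indicator (trans (cycle-next v w) (cong ((next v == w) ∨_) next-w≡v)) ⟩
  indicator ((next v == w) ∨ (prev v == w))
    ≡⟨ indicator-∨ (next v == w) (prev v == w) (λ s p → next≢prev v (trans (==⇒≡ s) (sym (==⇒≡ p)))) ⟩
  δ (next v) w +ℚ δ (prev v) w
    ∎
  where
  next-w≡v : (next w == v) ≡ (prev v == w)
  next-w≡v = T-extensional (λ e → ≡⇒== (trans (cong prev (sym (==⇒≡ {a = next w} e))) (prev-next w)))
                           (λ e → ≡⇒== (trans (cong next (sym (==⇒≡ {a = prev v} e))) (next-prev v)))

cycle-· : ∀ {k} (z : Fin (3 + k) → ℚ) v → (cycle (3 + k) · z) v ≡ z (next v) +ℚ z (prev v)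
cycle-· {k} z v = begin
  ∑ (3 + k) (λ w → adjMatrix (cycle (3 + k)) v w *ℚ z w)
    ≡⟨ ∑-cong (3 + k) (λ w → trans (cong (_*ℚ z w) (adjMatrix-cycle v w))
                                   (ℚ.*-distribʳ-+ (z w) (δ (next v) w) (δ (prev v) w))) ⟩
  ∑ (3 + k) (λ w → δ (next v) w *ℚ z w +ℚ δ (prev v) w *ℚ z w)
    ≡⟨ ∑-distrib-+ (3 + k) (λ w → δ (next v) w *ℚ z w) (λ w → δ (prev v) w *ℚ z w) ⟩
  ∑ (3 + k) (λ w → δ (next v) w *ℚ z w) +ℚ ∑ (3 + k) (λ w → δ (prev v) w *ℚ z w)
    ≡⟨ cong₂ _+ℚ_ (∑-δ (3 + k) (next v) z) (∑-δ (3 + k) (prev v) z) ⟩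
  z (next v) +ℚ z (prev v)
    ∎

-- Periodic sequences

Periodic : ∀ {A : Set} → ℕ → (ℕ → A) → Set
Periodic p D = ∀ n → D (n + p) ≡ D n

periodic-cancel : ∀ {A : Set} {a b} {D : ℕ → A} → Periodic (a + b) D → Periodic b D → Periodic a D
periodic-cancel {a = a} {b} {D} per-a+b per-b n =
  trans (sym (per-b (n + a))) (trans (cong D (ℕ.+-assoc n a b)) (per-a+b n))

periodic-* : ∀ {A : Set} {p} {D : ℕ → A} → Periodic p D → ∀ q → Periodic (q * p) D
periodic-* {D = D} per-p zero    n = cong D (ℕ.+-identityʳ n)
periodic-* {p = p} {D} per-p (suc q) n =
  trans (cong D (sym (ℕ.+-assoc n p (q * p)))) (trans (periodic-* per-p q (n + p)) (per-p n))

walk-periodic : ∀ {k} → Periodic (suc k) (walk {k})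
walk-periodic {k} n = Fin.toℕ-injective (begin
  toℕ (walk (n + suc k))  ≡⟨ toℕ-walk (n + suc k) ⟩
  (n + suc k) % suc k     ≡⟨ [m+n]%n≡m%n n (suc k) ⟩
  n % suc k               ≡⟨ toℕ-walk n ⟨
  toℕ (walk n)            ∎)

module SixStepRecurrence (D : ℕ → ℚ) (D-rec : ∀ n → D (2 + n) ≡ D (1 + n) -ℚ D n) where

  antiperiodic-3 : ∀ n → D (3 + n) ≡ - D n
  antiperiodic-3 n = begin
    D (3 + n)                          ≡⟨ D-rec (1 + n) ⟩
    D (2 + n) -ℚ D (1 + n)             ≡⟨ cong (_-ℚ D (1 + n)) (D-rec n) ⟩
    (D (1 + n) -ℚ D n) -ℚ D (1 + n)    ≡⟨ cancel (D n) (D (1 + n)) ⟩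
    - D n                              ∎
    where
    cancel : ∀ a b → (b -ℚ a) -ℚ b ≡ - a
    cancel = solve-∀ ℚ-ring

  periodic-6 : Periodic 6 D
  periodic-6 n = begin
    D (n + 6)      ≡⟨ cong D (ℕ.+-comm n 6) ⟩
    D (3 + (3 + n)) ≡⟨ antiperiodic-3 (3 + n) ⟩
    - D (3 + n)    ≡⟨ cong -_ (antiperiodic-3 n) ⟩
    - (- D n)      ≡⟨ ⁻¹-involutive (D n) ⟩
    D n            ∎

  sign-flipping⇒zero : (∀ n → D (1 + n) ≡ - D n) → ∀ n → D n ≡ 0ℚ
  sign-flipping⇒zero flip n = x+x+x≡0⇒x≡0 (begin
    D n +ℚ (D n +ℚ D n)                ≡⟨ cong (_+ℚ (D n +ℚ D n)) D≡-2D ⟩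
    (- D n -ℚ D n) +ℚ (D n +ℚ D n)     ≡⟨ cancel (D n) ⟩
    0ℚ                                 ∎)
    where
    cancel : ∀ a → (- a -ℚ a) +ℚ (a +ℚ a) ≡ 0ℚ
    cancel = solve-∀ ℚ-ring
    D≡-2D : D n ≡ - D n -ℚ D n
    D≡-2D = begin
      D n                    ≡⟨ ⁻¹-involutive (D n) ⟨
      - (- D n)              ≡⟨ cong -_ (flip n) ⟨
      - D (1 + n)            ≡⟨ flip (1 + n) ⟨
      D (2 + n)              ≡⟨ D-rec n ⟩
      D (1 + n) -ℚ D n       ≡⟨ cong (_-ℚ D n) (flip n) ⟩
      - D n -ℚ D n           ∎

  -- ℓ ≡ 2, 4 (mod 6) reduces period ℓ to period 2 or 4; with the antiperiod 3 either one flips the sign.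
  periodic⇒zero : ∀ ℓ → ℓ % 6 ≡ 2 ⊎ ℓ % 6 ≡ 4 → Periodic ℓ D → ∀ n → D n ≡ 0ℚ
  periodic⇒zero ℓ ℓ%6 per-ℓ = sign-flipping⇒zero (flip ℓ%6)
    where
    per-ℓ%6 : Periodic (ℓ % 6) D
    per-ℓ%6 = periodic-cancel (subst (λ p → Periodic p D) (m≡m%n+[m/n]*n ℓ 6) per-ℓ)
                              (periodic-* periodic-6 (ℓ / 6))
    flip : ℓ % 6 ≡ 2 ⊎ ℓ % 6 ≡ 4 → ∀ n → D (1 + n) ≡ - D n
    flip (inj₁ ℓ%6≡2) n = begin
      D (1 + n)            ≡⟨ subst (λ p → Periodic p D) ℓ%6≡2 per-ℓ%6 (1 + n) ⟨
      D (1 + n + 2)        ≡⟨ cong D (ℕ.+-comm (1 + n) 2) ⟩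
      D (3 + n)            ≡⟨ antiperiodic-3 n ⟩
      - D n                ∎
    flip (inj₂ ℓ%6≡4) n = begin
      D (1 + n)            ≡⟨ ⁻¹-involutive (D (1 + n)) ⟨
      - (- D (1 + n))      ≡⟨ cong -_ (antiperiodic-3 (1 + n)) ⟨
      - D (4 + n)          ≡⟨ cong (-_ ∘ D) (ℕ.+-comm 4 n) ⟩
      - D (n + 4)          ≡⟨ cong -_ (subst (λ p → Periodic p D) ℓ%6≡4 per-ℓ%6 n) ⟩
      - D n                ∎

progression-descends : ∀ {d} (E : ℕ → ℚ) → (∀ n → E (suc n) ≡ E n +ℚ d) → d <ℚ 0ℚ →
  ∀ k → E (suc k) <ℚ E 0
progression-descends {d} E step d<0 = descends
  where
  drop : ∀ n → E (suc n) <ℚ E n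
  drop n = ℚ.<-respˡ-≡ (sym (step n)) (ℚ.<-respʳ-≡ (ℚ.+-identityʳ (E n)) (ℚ.+-monoʳ-< (E n) d<0))
  descends : ∀ k → E (suc k) <ℚ E 0
  descends zero    = drop 0
  descends (suc k) = ℚ.<-trans (drop (suc k)) (descends k)

progression-returns⇒difference-zero : ∀ {d} (E : ℕ → ℚ) → (∀ n → E (suc n) ≡ E n +ℚ d) →
  ∀ k → E (suc k) ≡ E 0 → d ≡ 0ℚ
progression-returns⇒difference-zero {d} E step k returns with ℚ.<-cmp d 0ℚ
... | tri< d<0 _ _ = ⊥-elim (ℚ.<-irrefl returns (progression-descends E step d<0 k))
... | tri≈ _ d≡0 _ = d≡0
... | tri> _ _ d>0 =
  ⊥-elim (ℚ.<-irrefl (cong -_ returns) (progression-descends (-_ ∘ E) -step (ℚ.neg-antimono-< d>0) k))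
  where
  -step : ∀ n → - E (suc n) ≡ - E n +ℚ - d
  -step n = trans (cong -_ (step n)) (ℚ.neg-distrib-+ (E n) d)

arithmetic-periodic⇒constant : (E : ℕ → ℚ) → (∀ n → E (2 + n) -ℚ E (1 + n) ≡ E (1 + n) -ℚ E n) →
  ∀ k → E (suc k) ≡ E 0 → ∀ n → E n ≡ E 0
arithmetic-periodic⇒constant E second-difference k returns = constant
  where
  d : ℚ
  d = E 1 -ℚ E 0
  difference : ∀ n → E (suc n) -ℚ E n ≡ d
  difference zero    = refl
  difference (suc n) = trans (second-difference n) (difference n)
  step : ∀ n → E (suc n) ≡ E n +ℚ d
  step n = trans (restore (E (suc n)) (E n)) (cong (E n +ℚ_) (difference n))
    where
    restore : ∀ x y → x ≡ y +ℚ (x -ℚ y)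
    restore = solve-∀ ℚ-ring
  d≡0 : d ≡ 0ℚ
  d≡0 = progression-returns⇒difference-zero E step k returns
  constant : ∀ n → E n ≡ E 0
  constant zero    = refl
  constant (suc n) = trans (step n) (trans (cong₂ _+ℚ_ (constant n) d≡0) (ℚ.+-identityʳ (E 0)))

alternating : ℕ → ℚ
alternating zero    = 1ℚ
alternating (suc n) = - alternating n

alternating-+ : ∀ m n → alternating (m + n) ≡ alternating m *ℚ alternating n
alternating-+ zero    n = sym (ℚ.*-identityˡ (alternating n))
alternating-+ (suc m) n = trans (cong -_ (alternating-+ m n)) (ℚ.neg-distribˡ-* (alternating m) (alternating n))

alternating² : ∀ n → alternating n *ℚ alternating n ≡ 1ℚ
alternating² zero    = refl
alternating² (suc n) = trans (square-neg (alternating n)) (alternating² n)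
  where
  square-neg : ∀ a → (- a) *ℚ (- a) ≡ a *ℚ a
  square-neg = solve-∀ ℚ-ring

alternating≢0 : ∀ n → alternating n ≢ 0ℚ
alternating≢0 n a≡0 with trans (sym (alternating² n)) (cong₂ _*ℚ_ a≡0 a≡0)
... | ()

alternating-* : ∀ {p} → alternating p ≡ 1ℚ → ∀ q → alternating (q * p) ≡ 1ℚ
alternating-* {p} a≡1 zero    = refl
alternating-* {p} a≡1 (suc q) =
  trans (alternating-+ p (q * p)) (cong₂ _*ℚ_ a≡1 (alternating-* a≡1 q))

alternating-% : ∀ {p} .{{_ : NonZero p}} → alternating p ≡ 1ℚ → ∀ n → alternating (n % p) ≡ alternating n
alternating-% {p} a≡1 n = sym (begin
  alternating n                                    ≡⟨ cong alternating (m≡m%n+[m/n]*n n p) ⟩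
  alternating (n % p + n / p * p)                  ≡⟨ alternating-+ (n % p) (n / p * p) ⟩
  alternating (n % p) *ℚ alternating (n / p * p)   ≡⟨ cong (alternating (n % p) *ℚ_) (alternating-* a≡1 (n / p)) ⟩
  alternating (n % p) *ℚ 1ℚ                        ≡⟨ ℚ.*-identityʳ (alternating (n % p)) ⟩
  alternating (n % p)                              ∎)

alternating-even : ∀ {n} → n % 2 ≡ 0 → alternating n ≡ 1ℚ
alternating-even {n} n-even = trans (sym (alternating-% refl n)) (cong alternating n-even)

alternating-next : ∀ {k} → suc k % 2 ≡ 0 → ∀ (v : Fin (suc k)) →
  alternating (toℕ (next v)) ≡ - alternating (toℕ v)
alternating-next {k} even v = begin
  alternating (toℕ (next v))         ≡⟨ cong alternating (toℕ-next v) ⟩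
  alternating ((toℕ v + 1) % suc k)  ≡⟨ alternating-% {suc k} (alternating-even {suc k} even) (toℕ v + 1) ⟩
  alternating (toℕ v + 1)            ≡⟨ cong alternating (ℕ.+-comm (toℕ v) 1) ⟩
  - alternating (toℕ v)              ∎

alternating-prev : ∀ {k} → suc k % 2 ≡ 0 → ∀ (v : Fin (suc k)) →
  alternating (toℕ (prev v)) ≡ - alternating (toℕ v)
alternating-prev even v = begin
  alternating (toℕ (prev v))          ≡⟨ ⁻¹-involutive (alternating (toℕ (prev v))) ⟨
  - (- alternating (toℕ (prev v)))    ≡⟨ cong -_ (alternating-next even (prev v)) ⟨
  - alternating (toℕ (next (prev v))) ≡⟨ cong (-_ ∘ alternating ∘ toℕ) (next-prev v) ⟩
  - alternating (toℕ v)               ∎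

-- The graph C₃ □ Cₗ

module C₃□C (k : ℕ) where

  ℓ : ℕ
  ℓ = 3 + k

  G : AdjFn (3 * ℓ)
  G = cycle 3 □ cycle ℓ

  ⟪_,_⟫ : Fin 3 → Fin ℓ → Fin (3 * ℓ)
  ⟪ u , v ⟫ = combine u v

  G·-⟪⟫ : ∀ y u v → (G · y) ⟪ u , v ⟫ ≡
    (y ⟪ next u , v ⟫ +ℚ y ⟪ prev u , v ⟫) +ℚ (y ⟪ u , next v ⟫ +ℚ y ⟪ u , prev v ⟫)
  G·-⟪⟫ y u v =
    trans (□-· {G = cycle 3} (cycle ℓ) (proj₂ cycle-simple) y u v)
          (cong₂ _+ℚ_ (cycle-· (λ u' → y ⟪ u' , v ⟫) u) (cycle-· (λ v' → y ⟪ u , v' ⟫) v))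

  alternatingVector : Fin (3 * ℓ) → ℚ
  alternatingVector i = alternating (toℕ (proj₂ (remQuot {3} ℓ i)))

  alternatingVector-⟪⟫ : ∀ u v → alternatingVector ⟪ u , v ⟫ ≡ alternating (toℕ v)
  alternatingVector-⟪⟫ u v = cong (alternating ∘ toℕ ∘ proj₂) (Fin.remQuot-combine u v)

  alternatingVector≢0 : ∀ i → alternatingVector i ≢ 0ℚ
  alternatingVector≢0 i = alternating≢0 (toℕ (proj₂ (remQuot {3} ℓ i)))

  alternatingVector-kernel : ℓ % 2 ≡ 0 → InKernel G alternatingVector
  alternatingVector-kernel ℓ-even = ∀-combine {P = λ i → (G · alternatingVector) i ≡ 0ℚ} λ u v → begin
    (G · alternatingVector) ⟪ u , v ⟫
      ≡⟨ G·-⟪⟫ alternatingVector u v ⟩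
    (alternatingVector ⟪ next u , v ⟫ +ℚ alternatingVector ⟪ prev u , v ⟫)
      +ℚ (alternatingVector ⟪ u , next v ⟫ +ℚ alternatingVector ⟪ u , prev v ⟫)
      ≡⟨ cong₂ _+ℚ_ (cong₂ _+ℚ_ (alternatingVector-⟪⟫ (next u) v) (alternatingVector-⟪⟫ (prev u) v))
                    (cong₂ _+ℚ_ (trans (alternatingVector-⟪⟫ u (next v)) (alternating-next ℓ-even v))
                                (trans (alternatingVector-⟪⟫ u (prev v)) (alternating-prev ℓ-even v))) ⟩
    (alternating (toℕ v) +ℚ alternating (toℕ v)) +ℚ (- alternating (toℕ v) +ℚ - alternating (toℕ v))
      ≡⟨ cancel (alternating (toℕ v)) ⟩
    0ℚ
      ∎
    where
    cancel : ∀ a → (a +ℚ a) +ℚ (- a +ℚ - a) ≡ 0ℚ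
    cancel = solve-∀ ℚ-ring

  module KernelElement (ℓ-even : ℓ % 2 ≡ 0) (ℓ%6 : ℓ % 6 ≡ 2 ⊎ ℓ % 6 ≡ 4)
                       (y : Fin (3 * ℓ) → ℚ) (y∈ker : InKernel G y) where

    row : Fin 3 → ℕ → ℚ
    row u n = y ⟪ u , walk n ⟫

    row-periodic : ∀ u → Periodic ℓ (row u)
    row-periodic u n = cong (λ v → y ⟪ u , v ⟫) (walk-periodic n)

    row-equation : ∀ u n → (row (next u) (1 + n) +ℚ row (prev u) (1 + n)) +ℚ (row u (2 + n) +ℚ row u n) ≡ 0ℚ
    row-equation u n = begin
      (row (next u) (1 + n) +ℚ row (prev u) (1 + n)) +ℚ (row u (2 + n) +ℚ row u n)
        ≡⟨ cong (λ v → (row (next u) (1 + n) +ℚ row (prev u) (1 + n)) +ℚ (row u (2 + n) +ℚ y ⟪ u , v ⟫))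
                (prev-next (walk n)) ⟨
      (y ⟪ next u , walk (1 + n) ⟫ +ℚ y ⟪ prev u , walk (1 + n) ⟫)
        +ℚ (y ⟪ u , next (walk (1 + n)) ⟫ +ℚ y ⟪ u , prev (walk (1 + n)) ⟫)
        ≡⟨ G·-⟪⟫ y u (walk (1 + n)) ⟨
      (G · y) ⟪ u , walk (1 + n) ⟫
        ≡⟨ y∈ker ⟪ u , walk (1 + n) ⟫ ⟩
      0ℚ
        ∎

    difference : Fin 3 → ℕ → ℚ
    difference u n = row u n -ℚ row (next u) n

    difference-recurrence : ∀ u n → difference u (2 + n) ≡ difference u (1 + n) -ℚ difference u n
    difference-recurrence u n = begin
      difference u (2 + n)
        ≡⟨ rearrange (row u n) (row u (1 + n)) (row u (2 + n)) (B n) (B (1 + n)) (B (2 + n)) (C (1 + n)) ⟩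
      (difference u (1 + n) -ℚ difference u n) +ℚ (L-u -ℚ L-next-u)
        ≡⟨ cong₂ (λ p q → (difference u (1 + n) -ℚ difference u n) +ℚ (p -ℚ q))
                 (row-equation u n) next-u-equation ⟩
      (difference u (1 + n) -ℚ difference u n) +ℚ 0ℚ
        ≡⟨ ℚ.+-identityʳ _ ⟩
      difference u (1 + n) -ℚ difference u n
        ∎
      where
      B C : ℕ → ℚ
      B = row (next u)
      C = row (prev u)
      L-u L-next-u : ℚ
      L-u      = (B (1 + n) +ℚ C (1 + n)) +ℚ (row u (2 + n) +ℚ row u n)
      L-next-u = (C (1 + n) +ℚ row u (1 + n)) +ℚ (B (2 + n) +ℚ B n)
      next²≡prev : ∀ (w : Fin 3) → next (next w) ≡ prev w
      next²≡prev zero             = refl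
      next²≡prev (suc zero)       = refl
      next²≡prev (suc (suc zero)) = refl
      next-u-equation : L-next-u ≡ 0ℚ
      next-u-equation =
        subst₂ (λ w w' → (row w (1 + n) +ℚ row w' (1 + n)) +ℚ (B (2 + n) +ℚ B n) ≡ 0ℚ)
               (next²≡prev u) (prev-next u) (row-equation (next u) n)
      rearrange : ∀ a₀ a₁ a₂ b₀ b₁ b₂ c₁ → a₂ -ℚ b₂ ≡
        ((a₁ -ℚ b₁) -ℚ (a₀ -ℚ b₀))
          +ℚ (((b₁ +ℚ c₁) +ℚ (a₂ +ℚ a₀)) -ℚ ((c₁ +ℚ a₁) +ℚ (b₂ +ℚ b₀)))
      rearrange = solve-∀ ℚ-ring

    rows-agree : ∀ u n → row u n ≡ row (next u) n
    rows-agree u n = x∙y⁻¹≈ε⇒x≈y (row u n) (row (next u) n)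
      (SixStepRecurrence.periodic⇒zero (difference u) (difference-recurrence u) ℓ ℓ%6
        (λ m → cong₂ _-ℚ_ (row-periodic u m) (row-periodic (next u) m)) n)

    f : ℕ → ℚ
    f = row zero

    row≡f : ∀ u n → row u n ≡ f n
    row≡f zero             n = refl
    row≡f (suc zero)       n = sym (rows-agree zero n)
    row≡f (suc (suc zero)) n = trans (sym (rows-agree (suc zero) n)) (row≡f (suc zero) n)

    f-equation : ∀ n → (f (1 + n) +ℚ f (1 + n)) +ℚ (f (2 + n) +ℚ f n) ≡ 0ℚ
    f-equation n = subst₂ (λ p q → (p +ℚ q) +ℚ (f (2 + n) +ℚ f n) ≡ 0ℚ)
                          (row≡f (suc zero) (1 + n)) (row≡f (suc (suc zero)) (1 + n)) (row-equation zero n)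

    E : ℕ → ℚ
    E n = alternating n *ℚ f n

    E-second-difference : ∀ n → E (2 + n) -ℚ E (1 + n) ≡ E (1 + n) -ℚ E n
    E-second-difference n = begin
      E (2 + n) -ℚ E (1 + n)
        ≡⟨ rearrange (alternating n) (f n) (f (1 + n)) (f (2 + n)) ⟩
      (E (1 + n) -ℚ E n) +ℚ alternating n *ℚ ((f (1 + n) +ℚ f (1 + n)) +ℚ (f (2 + n) +ℚ f n))
        ≡⟨ cong (λ t → (E (1 + n) -ℚ E n) +ℚ alternating n *ℚ t) (f-equation n) ⟩
      (E (1 + n) -ℚ E n) +ℚ alternating n *ℚ 0ℚ
        ≡⟨ trans (cong ((E (1 + n) -ℚ E n) +ℚ_) (ℚ.*-zeroʳ (alternating n))) (ℚ.+-identityʳ _) ⟩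
      E (1 + n) -ℚ E n
        ∎
      where
      rearrange : ∀ a f₀ f₁ f₂ → (- (- a)) *ℚ f₂ -ℚ (- a) *ℚ f₁ ≡
        ((- a) *ℚ f₁ -ℚ a *ℚ f₀) +ℚ a *ℚ ((f₁ +ℚ f₁) +ℚ (f₂ +ℚ f₀))
      rearrange = solve-∀ ℚ-ring

    E-constant : ∀ n → E n ≡ E 0
    E-constant = arithmetic-periodic⇒constant E E-second-difference (2 + k)
      (cong₂ _*ℚ_ (alternating-even {ℓ} ℓ-even) (row-periodic zero 0))

    f≡E₀*alternating : ∀ n → f n ≡ E 0 *ℚ alternating n
    f≡E₀*alternating n = begin
      f n                                    ≡⟨ ℚ.*-identityˡ (f n) ⟨
      1ℚ *ℚ f n                              ≡⟨ cong (_*ℚ f n) (alternating² n) ⟨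
      (alternating n *ℚ alternating n) *ℚ f n ≡⟨ ℚ.*-assoc (alternating n) (alternating n) (f n) ⟩
      alternating n *ℚ E n                   ≡⟨ cong (alternating n *ℚ_) (E-constant n) ⟩
      alternating n *ℚ E 0                   ≡⟨ ℚ.*-comm (alternating n) (E 0) ⟩
      E 0 *ℚ alternating n                   ∎

    y≡E₀*alternatingVector : ∀ i → y i ≡ E 0 *ℚ alternatingVector i
    y≡E₀*alternatingVector = ∀-combine {P = λ i → y i ≡ E 0 *ℚ alternatingVector i} λ u v → begin
      y ⟪ u , v ⟫                      ≡⟨ cong (λ w → y ⟪ u , w ⟫) (walk-toℕ v) ⟨
      row u (toℕ v)                   ≡⟨ row≡f u (toℕ v) ⟩
      f (toℕ v)                       ≡⟨ f≡E₀*alternating (toℕ v) ⟩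
      E 0 *ℚ alternating (toℕ v)      ≡⟨ cong (E 0 *ℚ_) (alternatingVector-⟪⟫ u v) ⟨
      E 0 *ℚ alternatingVector ⟪ u , v ⟫ ∎

even-not-multiple-of-6 : ∀ ℓ → ℓ % 2 ≡ 0 → ¬ (ℓ % 6 ≡ 0) → ℓ % 6 ≡ 2 ⊎ ℓ % 6 ≡ 4
even-not-multiple-of-6 ℓ ℓ-even ℓ≢0 =
  residue (ℓ % 6) (m%n<n ℓ 6) (trans (m∣n⇒o%n%m≡o%m 2 6 ℓ (divides 3 refl)) ℓ-even) ℓ≢0
  where
  residue : ∀ r → r < 6 → r % 2 ≡ 0 → r ≢ 0 → r ≡ 2 ⊎ r ≡ 4
  residue 0 _ _  r≢0 = ⊥-elim (r≢0 refl)
  residue 2 _ _  _   = inj₁ refl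
  residue 4 _ _  _   = inj₂ refl
  residue 1 _ () _
  residue 3 _ () _
  residue 5 _ () _
  residue (suc (suc (suc (suc (suc (suc _)))))) (s≤s (s≤s (s≤s (s≤s (s≤s (s≤s ())))))) _ _

proposition12 : (ℓ : ℕ) → 4 ≤ ℓ → ℓ % 2 ≡ 0 → ¬ (ℓ % 6 ≡ 0) →
    IsNutGraph (cycle 3 □ cycle ℓ)
proposition12 (suc (suc (suc k))) (s≤s (s≤s (s≤s _))) ℓ-even ℓ≢0 =
    □-simple cycle-simple cycle-simple
  , □-connected cycle-connected cycle-connected
  , alternatingVector
  , alternatingVector-kernel ℓ-even
  , alternatingVector≢0
  , λ y y∈ker → let open KernelElement ℓ-even (even-not-multiple-of-6 ℓ ℓ-even ℓ≢0) y y∈ker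
                in E 0 , y≡E₀*alternatingVector
  where
  open C₃□C k
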